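{- Let $\rho=\frac12+\frac{\sqrt3}{2}i$ and let $n$ be a positive integer. Then the horizontal segment $\{x+i\sqrt{3}/n: 0\le x\le 1\}$ contains a $\Gamma(1)$-image of $\rho$ (i.e. a point $A(\rho)$ with $A\in SL(2,\mathbb{Z})$) if and only if $n=2(c^2+cd+d^2)$ for some integers $c,d$ with $\gcd(c,d)=1$. Moreover, there exist $n$ for which this segment contains more than one $\Gamma(1)$-image of $\rho$.
   Context: $SL(2,\mathbb{Z})$ acts on the upper half-plane by $z\mapsto (az+b)/(cz+d)$; for $A=\begin{pmatrix}a&b\\c&d\end{pmatrix}$ one has $\Im A(\rho)=\sqrt3/(2(c^2+cd+d^2))$. -}

module Defs where

open import Data.Integer as ℤ using (ℤ; +_)
open import Data.Rational as ℚ using (ℚ; 0ℚ; 1ℚ; _/_; ≢-nonZero)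
open import Data.Rational.Properties using (_≟_)
open import Data.Nat using (ℕ; NonZero)
open import Data.Product using (Σ; _×_; _,_)
open import Relation.Nullary using (yes; no)
open import Relation.Binary.PropositionalEquality using (_≡_)

-- Elements of the field ℚ(√-3) ⊂ ℂ, written  re + im·(i√3)  with re, im ∈ ℚ.
-- Such an element is the complex number with real part re and
-- imaginary part im·√3.
record Qω : Set where
  constructor _+_i√3
  field
    re : ℚ
    im : ℚ
open Qω public

-- field operations (with s = i√3, s² = -3)
infixl 6 _⊕_
infixl 7 _⊗_
_⊕_ : Qω → Qω → Qω
(a + b i√3) ⊕ (c + d i√3) = (a ℚ.+ c) + (b ℚ.+ d) i√3

_⊗_ : Qω → Qω → Qω
(a + b i√3) ⊗ (c + d i√3) =
  (a ℚ.* c ℚ.- (+ 3 / 1) ℚ.* (b ℚ.* d)) + (a ℚ.* d ℚ.+ b ℚ.* c) i√3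

normω : Qω → ℚ
normω (a + b i√3) = a ℚ.* a ℚ.+ (+ 3 / 1) ℚ.* (b ℚ.* b)

-- multiplicative inverse (total: 0⁻¹ := 0, which never occurs below)
invω : Qω → Qω
invω z with normω z ≟ 0ℚ
... | yes _ = 0ℚ + 0ℚ i√3
... | no ≢0 = let instance _ = ≢-nonZero ≢0 in
              (re z ℚ.÷ normω z) + (ℚ.- (im z ℚ.÷ normω z)) i√3

fromℤ : ℤ → Qω
fromℤ k = (k / 1) + 0ℚ i√3

ρ : Qω
ρ = (+ 1 / 2) + (+ 1 / 2) i√3

record SL2Z : Set where
  constructor mat
  field
    a b c d : ℤ
    det≡1 : a ℤ.* d ℤ.- b ℤ.* c ≡ + 1
open SL2Z public

act : SL2Z → Qω → Qω
act A z = (fromℤ (a A) ⊗ z ⊕ fromℤ (b A)) ⊗ invω (fromℤ (c A) ⊗ z ⊕ fromℤ (d A))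

-- z lies on the horizontal segment { x + i√3/n : 0 ≤ x ≤ 1 }
-- (z = x + y·i√3 with x, y rational; the point x + i√3/n has y = 1/n)
OnSegment : (n : ℕ) → .{{_ : NonZero n}} → Qω → Set
OnSegment n z = (im z ≡ + 1 / n) × (0ℚ ℚ.≤ re z) × (re z ℚ.≤ 1ℚ)

-- Multiplying numerator and denominator of A(ρ) = (aρ + b)/(cρ + d) by the conjugate of
-- cρ + d gives A(ρ) = (M + i√3)/(2K), where K = c² + cd + d² = |cρ + d|² and
-- M = 2ac + 2bd + ad + bc is the trace of (aρ + b)·conj(cρ + d); the imaginary part uses
-- ad − bc = 1, and K ≠ 0 because 4·|aρ + b|²·K = M² + 3.  Hence A(ρ) lies on the segment
-- of height √3/n exactly when n = 2K and 0 ≤ M ≤ n.  The bottom row of a matrix in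
-- SL(2,ℤ) is coprime; conversely a coprime (c, d) is completed to a matrix by Bézout, and
-- replacing the top row (a, b) by (a − kc, b − kd), i.e. composing with z ↦ z − k, changes
-- M by −2kK = −kn, so that M can be moved into [0, n).  For n = 14 the rows (1, 2) and
-- (2, 1) both have K = 7 and give two different points.
{-# OPTIONS --safe #-}
module Submission where

open import Defs
open import Level using (0ℓ)
open import Data.Empty using (⊥-elim)
open import Data.Product using (Σ; ∃; ∃-syntax; _×_; _,_; proj₁; proj₂)
open import Data.Nat as ℕ using (ℕ; NonZero; suc)
import Data.Nat.Properties as ℕP
open import Data.Nat.Divisibility using (∣1⇒≡1)
open import Data.Nat.GCD using (GCD; gcd-GCD; module Bézout)
open import Data.Integer using (ℤ; +_; -[1+_]; 0ℤ; _+_; _*_; _-_; -_; ∣_∣; +≤+) renaming (_≤_ to _≤ℤ_)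
import Data.Integer.Properties as ℤP
open import Data.Integer.DivMod using (_/ℕ_; _%ℕ_; a≡a%ℕn+[a/ℕn]*n; n%ℕd<d)
open import Data.Integer.Divisibility.Signed using (∣ᵤ⇒∣; ∣⇒∣ᵤ; ∣m∣n⇒∣m-n; ∣n⇒∣m*n) renaming (_∣_ to _∣ℤ_)
open import Data.Integer.GCD using (gcd; gcd[i,j]∣i; gcd[i,j]∣j)
open import Data.Integer.Tactic.RingSolver using (solve-∀)
open import Data.Rational as ℚ using (ℚ; 0ℚ; 1ℚ; _/_; toℚᵘ; fromℚᵘ)
import Data.Rational.Properties as ℚP
open import Data.Rational.Unnormalised using (mkℚᵘ; *≡*; *≤*) renaming (_≃_ to _≃ᵘ_)
import Data.Rational.Unnormalised.Properties as ℚᵘP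
open import Function.Bundles using (_⇔_; mk⇔)
open import Relation.Nullary.Decidable using (yes; no; True; dec⇒maybe; toWitness)
open import Relation.Binary.PropositionalEquality
  using (_≡_; _≢_; refl; sym; trans; cong; cong₂; subst; subst₂; module ≡-Reasoning)
open import Tactic.RingSolver using () renaming (solve-∀ to solve-∀ℚ)
open import Tactic.RingSolver.Core.AlmostCommutativeRing using (AlmostCommutativeRing; fromCommutativeRing)

ℚ-ring : AlmostCommutativeRing 0ℓ 0ℓ
ℚ-ring = fromCommutativeRing ℚP.+-*-commutativeRing (λ p → dec⇒maybe (0ℚ ℚP.≟ p))

ι : ℤ → ℚ
ι i = i / 1

½ : ℚ
½ = + 1 / 2

≡fromℚᵘ : ∀ {p} q → toℚᵘ p ≃ᵘ q → p ≡ fromℚᵘ q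
≡fromℚᵘ {p} q p≃q = trans (sym (ℚP.fromℚᵘ-toℚᵘ p)) (ℚP.fromℚᵘ-cong p≃q)

toℚᵘ-/ : ∀ i m → toℚᵘ (i / suc m) ≃ᵘ mkℚᵘ i m
toℚᵘ-/ i m = ℚP.toℚᵘ-fromℚᵘ (mkℚᵘ i m)

ι-+ : ∀ i j → ι (i + j) ≡ ι i ℚ.+ ι j
ι-+ i j = sym (≡fromℚᵘ (mkℚᵘ (i + j) 0) (ℚᵘP.≃-trans (ℚP.toℚᵘ-homo-+ (ι i) (ι j))
  (ℚᵘP.≃-trans (ℚᵘP.+-cong (toℚᵘ-/ i 0) (toℚᵘ-/ j 0)) (*≡* (lemma i j)))))
  where
  lemma : ∀ i j → (i * + 1 + j * + 1) * + 1 ≡ (i + j) * + 1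
  lemma = solve-∀

ι-* : ∀ i j → ι (i * j) ≡ ι i ℚ.* ι j
ι-* i j = sym (≡fromℚᵘ (mkℚᵘ (i * j) 0) (ℚᵘP.≃-trans (ℚP.toℚᵘ-homo-* (ι i) (ι j))
  (ℚᵘP.*-cong (toℚᵘ-/ i 0) (toℚᵘ-/ j 0))))

ι-neg : ∀ i → ι (- i) ≡ ℚ.- ι i
ι-neg i = sym (≡fromℚᵘ (mkℚᵘ (- i) 0) (ℚᵘP.≃-trans (ℚP.toℚᵘ-homo‿- (ι i)) (ℚᵘP.-‿cong (toℚᵘ-/ i 0))))

ι-injective : ∀ {i j} → ι i ≡ ι j → i ≡ j
ι-injective {i} {j} ιi≡ιj with ℚP.fromℚᵘ-injective {mkℚᵘ i 0} {mkℚᵘ j 0} ιi≡ιj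
... | *≡* i*1≡j*1 = trans (sym (ℤP.*-identityʳ i)) (trans i*1≡j*1 (ℤP.*-identityʳ j))

ι*1/n≡/ : ∀ j m → ι j ℚ.* (+ 1 / suc m) ≡ j / suc m
ι*1/n≡/ j m = ≡fromℚᵘ (mkℚᵘ j m) (ℚᵘP.≃-trans (ℚP.toℚᵘ-homo-* (ι j) (+ 1 / suc m))
  (ℚᵘP.≃-trans (ℚᵘP.*-cong (toℚᵘ-/ j 0) (toℚᵘ-/ (+ 1) m))
    (*≡* (cong₂ _*_ (ℤP.*-identityʳ j) (cong (λ k → + suc k) (sym (ℕP.+-identityʳ m)))))))

ι[n]*1/n≡1 : ∀ m → ι (+ suc m) ℚ.* (+ 1 / suc m) ≡ 1ℚ
ι[n]*1/n≡1 m = trans (ι*1/n≡/ (+ suc m) m) n/n≡1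
  where
  n/n≡1 : + suc m / suc m ≡ 1ℚ
  n/n≡1 = ℚP.fromℚᵘ-cong {mkℚᵘ (+ suc m) m} {mkℚᵘ (+ 1) 0} (*≡* (ℤP.*-comm (+ suc m) (+ 1)))

0≤r/n≤1 : ∀ {r m} → r ℕ.< suc m → (0ℚ ℚ.≤ + r / suc m) × (+ r / suc m ℚ.≤ 1ℚ)
0≤r/n≤1 {r} {m} r<n =
  ℚP.toℚᵘ-cancel-≤ (ℚᵘP.≤-respʳ-≃ (ℚᵘP.≃-sym (toℚᵘ-/ (+ r) m)) (*≤* 0≤r*1)) ,
  ℚP.toℚᵘ-cancel-≤ (ℚᵘP.≤-respˡ-≃ (ℚᵘP.≃-sym (toℚᵘ-/ (+ r) m)) (*≤* r*1≤1*n))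
  where
  0≤r*1 : 0ℤ ≤ℤ + r * + 1
  0≤r*1 = subst (0ℤ ≤ℤ_) (sym (ℤP.*-identityʳ (+ r))) (+≤+ ℕ.z≤n)
  r*1≤1*n : + r * + 1 ≤ℤ + 1 * + suc m
  r*1≤1*n = subst₂ _≤ℤ_ (sym (ℤP.*-identityʳ (+ r))) (sym (ℤP.*-identityˡ (+ suc m)))
    (+≤+ (ℕP.<⇒≤ r<n))

*-inverseʳ-unique : ∀ {x y s} → x ℚ.* s ≡ 1ℚ → y ℚ.* s ≡ 1ℚ → x ≡ y
*-inverseʳ-unique {x} {y} {s} xs≡1 ys≡1 = begin
  x                  ≡⟨ sym (ℚP.*-identityʳ x) ⟩
  x ℚ.* 1ℚ           ≡⟨ cong (x ℚ.*_) (sym ys≡1) ⟩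
  x ℚ.* (y ℚ.* s)    ≡⟨ rearrange x y s ⟩
  (x ℚ.* s) ℚ.* y    ≡⟨ cong (ℚ._* y) xs≡1 ⟩
  1ℚ ℚ.* y           ≡⟨ ℚP.*-identityˡ y ⟩
  y                  ∎
  where
  open ≡-Reasoning
  rearrange : ∀ x y s → x ℚ.* (y ℚ.* s) ≡ (x ℚ.* s) ℚ.* y
  rearrange = solve-∀ℚ ℚ-ring

invω-conj : ∀ z t → normω z ℚ.* t ≡ 1ℚ → invω z ≡ (re z ℚ.* t) + (ℚ.- (im z ℚ.* t)) i√3
invω-conj z t Nt≡1 with normω z ℚP.≟ 0ℚ
... | yes N≡0 = ⊥-elim (ℚP.1≢0 (begin
  1ℚ              ≡⟨ sym Nt≡1 ⟩
  normω z ℚ.* t   ≡⟨ cong (ℚ._* t) N≡0 ⟩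
  0ℚ ℚ.* t        ≡⟨ ℚP.*-zeroˡ t ⟩
  0ℚ              ∎))
  where open ≡-Reasoning
... | no N≢0 = cong₂ (λ s s′ → (re z ℚ.* s) + (ℚ.- (im z ℚ.* s′)) i√3) 1/N≡t 1/N≡t
  where
  instance _ = ℚ.≢-nonZero N≢0
  1/N≡t : ℚ.1/ normω z ≡ t
  1/N≡t = *-inverseʳ-unique (ℚP.*-inverseˡ (normω z)) (trans (ℚP.*-comm t (normω z)) Nt≡1)

ofℚ : ℚ → Qω
ofℚ x = x + 0ℚ i√3

xρ+y≡ : ∀ x y → ofℚ x ⊗ ρ ⊕ ofℚ y ≡ (x ℚ.* ½ ℚ.+ y) + (x ℚ.* ½) i√3
xρ+y≡ x y = cong₂ _+_i√3 (re-lemma x y) (im-lemma x y)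
  where
  re-lemma : ∀ x y → x ℚ.* ½ ℚ.- (+ 3 / 1) ℚ.* (0ℚ ℚ.* ½) ℚ.+ y ≡ x ℚ.* ½ ℚ.+ y
  re-lemma = solve-∀ℚ ℚ-ring
  im-lemma : ∀ x y → x ℚ.* ½ ℚ.+ 0ℚ ℚ.* ½ ℚ.+ 0ℚ ≡ x ℚ.* ½
  im-lemma = solve-∀ℚ ℚ-ring

norm-xρ+y : ∀ x y → normω ((x ℚ.* ½ ℚ.+ y) + (x ℚ.* ½) i√3) ≡ x ℚ.* x ℚ.+ x ℚ.* y ℚ.+ y ℚ.* y
norm-xρ+y x y = lemma x y
  where
  lemma : ∀ x y → (x ℚ.* ½ ℚ.+ y) ℚ.* (x ℚ.* ½ ℚ.+ y) ℚ.+ (+ 3 / 1) ℚ.* ((x ℚ.* ½) ℚ.* (x ℚ.* ½))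
                ≡ x ℚ.* x ℚ.+ x ℚ.* y ℚ.+ y ℚ.* y
  lemma = solve-∀ℚ ℚ-ring

möbius-ρ : ∀ α β γ δ t → (γ ℚ.* γ ℚ.+ γ ℚ.* δ ℚ.+ δ ℚ.* δ) ℚ.* t ≡ 1ℚ →
  (ofℚ α ⊗ ρ ⊕ ofℚ β) ⊗ invω (ofℚ γ ⊗ ρ ⊕ ofℚ δ)
    ≡ (t ℚ.* ½ ℚ.* ((+ 2 / 1) ℚ.* (α ℚ.* γ ℚ.+ β ℚ.* δ) ℚ.+ (α ℚ.* δ ℚ.+ β ℚ.* γ)))
      + (t ℚ.* ½ ℚ.* (α ℚ.* δ ℚ.- β ℚ.* γ)) i√3
möbius-ρ α β γ δ t Kt≡1 = begin
  (ofℚ α ⊗ ρ ⊕ ofℚ β) ⊗ invω (ofℚ γ ⊗ ρ ⊕ ofℚ δ)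
    ≡⟨ cong₂ (λ w u → w ⊗ invω u) (xρ+y≡ α β) (xρ+y≡ γ δ) ⟩
  w ⊗ invω u
    ≡⟨ cong (w ⊗_) (invω-conj u t (trans (cong (ℚ._* t) (norm-xρ+y γ δ)) Kt≡1)) ⟩
  w ⊗ ((re u ℚ.* t) + (ℚ.- (im u ℚ.* t)) i√3)
    ≡⟨ cong₂ _+_i√3 (re-lemma α β γ δ t) (im-lemma α β γ δ t) ⟩
  _ ∎
  where
  open ≡-Reasoning
  w u : Qω
  w = (α ℚ.* ½ ℚ.+ β) + (α ℚ.* ½) i√3
  u = (γ ℚ.* ½ ℚ.+ δ) + (γ ℚ.* ½) i√3
  re-lemma : ∀ α β γ δ t →
    (α ℚ.* ½ ℚ.+ β) ℚ.* ((γ ℚ.* ½ ℚ.+ δ) ℚ.* t)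
      ℚ.- (+ 3 / 1) ℚ.* ((α ℚ.* ½) ℚ.* (ℚ.- ((γ ℚ.* ½) ℚ.* t)))
    ≡ t ℚ.* ½ ℚ.* ((+ 2 / 1) ℚ.* (α ℚ.* γ ℚ.+ β ℚ.* δ) ℚ.+ (α ℚ.* δ ℚ.+ β ℚ.* γ))
  re-lemma = solve-∀ℚ ℚ-ring
  im-lemma : ∀ α β γ δ t →
    (α ℚ.* ½ ℚ.+ β) ℚ.* (ℚ.- ((γ ℚ.* ½) ℚ.* t)) ℚ.+ (α ℚ.* ½) ℚ.* ((γ ℚ.* ½ ℚ.+ δ) ℚ.* t)
    ≡ t ℚ.* ½ ℚ.* (α ℚ.* δ ℚ.- β ℚ.* γ)
  im-lemma = solve-∀ℚ ℚ-ring

ρ-norm : ℤ → ℤ → ℤ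
ρ-norm c d = c * c + c * d + d * d

ρ-trace : ℤ → ℤ → ℤ → ℤ → ℤ
ρ-trace a b c d = + 2 * (a * c + b * d) + (a * d + b * c)

ρ-trace-of : SL2Z → ℤ
ρ-trace-of A = ρ-trace (a A) (b A) (c A) (d A)

-- |aρ + b|² · |cρ + d|² = |(aρ + b)·conj(cρ + d)|², times 4.
ρ-norm-multiplicative : ∀ a b c d →
  + 4 * (ρ-norm a b * ρ-norm c d)
    ≡ + 3 * ((a * d - b * c) * (a * d - b * c)) + ρ-trace a b c d * ρ-trace a b c d
ρ-norm-multiplicative a b c d = expanded a b c d
  where
  expanded : ∀ a b c d →
    + 4 * ((a * a + a * b + b * b) * (c * c + c * d + d * d))
      ≡ + 3 * ((a * d - b * c) * (a * d - b * c))
        + (+ 2 * (a * c + b * d) + (a * d + b * c)) * (+ 2 * (a * c + b * d) + (a * d + b * c))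
  expanded = solve-∀

square≡+ : ∀ i → ∃[ k ] i * i ≡ + k
square≡+ (+ n)    = n ℕ.* n , ℤP.+◃n≡+n (n ℕ.* n)
square≡+ -[1+ n ] = _ , refl

ρ-norm-bottomRow≢0 : (A : SL2Z) → ρ-norm (c A) (d A) ≢ 0ℤ
ρ-norm-bottomRow≢0 (mat a b c d det) K≡0 with square≡+ (ρ-trace a b c d)
... | k , M²≡k = 3+k≢0 (begin
  + 3 + + k
    ≡⟨ cong₂ (λ D M² → + 3 * (D * D) + M²) (sym det) (sym M²≡k) ⟩
  + 3 * ((a * d - b * c) * (a * d - b * c)) + ρ-trace a b c d * ρ-trace a b c d
    ≡⟨ sym (ρ-norm-multiplicative a b c d) ⟩
  + 4 * (ρ-norm a b * ρ-norm c d)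
    ≡⟨ cong (λ K → + 4 * (ρ-norm a b * K)) K≡0 ⟩
  + 4 * (ρ-norm a b * 0ℤ)
    ≡⟨ cong (+ 4 *_) (ℤP.*-zeroʳ (ρ-norm a b)) ⟩
  0ℤ ∎)
  where
  open ≡-Reasoning
  3+k≢0 : + 3 + + k ≢ 0ℤ
  3+k≢0 ()

ι-*+* : ∀ a b c d → ι (a * c + b * d) ≡ ι a ℚ.* ι c ℚ.+ ι b ℚ.* ι d
ι-*+* a b c d = trans (ι-+ (a * c) (b * d)) (cong₂ ℚ._+_ (ι-* a c) (ι-* b d))

ι-ρ-norm : ∀ c d → ι (ρ-norm c d) ≡ ι c ℚ.* ι c ℚ.+ ι c ℚ.* ι d ℚ.+ ι d ℚ.* ι d
ι-ρ-norm c d = trans (ι-+ (c * c + c * d) (d * d)) (cong₂ ℚ._+_ (ι-*+* c c c d) (ι-* d d))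

ι-ρ-trace : ∀ a b c d → ι (ρ-trace a b c d)
  ≡ (+ 2 / 1) ℚ.* (ι a ℚ.* ι c ℚ.+ ι b ℚ.* ι d) ℚ.+ (ι a ℚ.* ι d ℚ.+ ι b ℚ.* ι c)
ι-ρ-trace a b c d = trans (ι-+ (+ 2 * (a * c + b * d)) (a * d + b * c))
  (cong₂ ℚ._+_ (trans (ι-* (+ 2) (a * c + b * d)) (cong (ι (+ 2) ℚ.*_) (ι-*+* a b c d)))
               (ι-*+* a b d c))

ι-det : ∀ a b c d → ι (a * d - b * c) ≡ ι a ℚ.* ι d ℚ.- ι b ℚ.* ι c
ι-det a b c d = trans (ι-+ (a * d) (- (b * c)))
  (cong₂ ℚ._+_ (ι-* a d) (trans (ι-neg (b * c)) (cong ℚ.-_ (ι-* b c))))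

ρ-norm-inverse : (A : SL2Z) → ∃[ t ] ι (ρ-norm (c A) (d A)) ℚ.* t ≡ 1ℚ
ρ-norm-inverse A = ℚ.1/ ι K , ℚP.*-inverseʳ (ι K)
  where
  K = ρ-norm (c A) (d A)
  instance _ = ℚ.≢-nonZero (λ ιK≡0 → ρ-norm-bottomRow≢0 A (ι-injective ιK≡0))

act-ρ : (A : SL2Z) → ∀ t → ι (ρ-norm (c A) (d A)) ℚ.* t ≡ 1ℚ →
  act A ρ ≡ (t ℚ.* ½ ℚ.* ι (ρ-trace-of A)) + (t ℚ.* ½) i√3
act-ρ (mat a b c d det) t Kt≡1 =
  -- fromℤ k is ofℚ (ι k), so act (mat a b c d _) ρ is the left-hand side of möbius-ρ.
  trans (möbius-ρ (ι a) (ι b) (ι c) (ι d) t (trans (cong (ℚ._* t) (sym (ι-ρ-norm c d))) Kt≡1))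
        (cong₂ _+_i√3 (cong (t ℚ.* ½ ℚ.*_) (sym (ι-ρ-trace a b c d)))
                      (trans (cong (t ℚ.* ½ ℚ.*_) (trans (sym (ι-det a b c d)) (cong ι det)))
                             (ℚP.*-identityʳ (t ℚ.* ½))))

im-act-ρ : (A : SL2Z) → ι (+ 2 * ρ-norm (c A) (d A)) ℚ.* im (act A ρ) ≡ 1ℚ
im-act-ρ A = let t , Kt≡1 = ρ-norm-inverse A in begin
  ι (+ 2 * K) ℚ.* im (act A ρ)   ≡⟨ cong₂ ℚ._*_ (ι-* (+ 2) K) (cong im (act-ρ A t Kt≡1)) ⟩
  ι (+ 2) ℚ.* ι K ℚ.* (t ℚ.* ½)  ≡⟨ two-halves (ι K) t ⟩
  ι K ℚ.* t                      ≡⟨ Kt≡1 ⟩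
  1ℚ                             ∎
  where
  open ≡-Reasoning
  K = ρ-norm (c A) (d A)
  two-halves : ∀ k t → (+ 2 / 1) ℚ.* k ℚ.* (t ℚ.* ½) ≡ k ℚ.* t
  two-halves = solve-∀ℚ ℚ-ring

re-act-ρ : (A : SL2Z) → re (act A ρ) ≡ ι (ρ-trace-of A) ℚ.* im (act A ρ)
re-act-ρ A = let t , Kt≡1 = ρ-norm-inverse A in
  trans (cong re (act-ρ A t Kt≡1))
        (trans (ℚP.*-comm (t ℚ.* ½) _) (cong (ι (ρ-trace-of A) ℚ.*_) (sym (cong im (act-ρ A t Kt≡1)))))

det≡1⇒gcd≡1 : ∀ a b c d → a * d - b * c ≡ + 1 → gcd c d ≡ + 1
det≡1⇒gcd≡1 a b c d det = cong +_ (∣1⇒≡1 (∣⇒∣ᵤ (subst (gcd c d ∣ℤ_) det gcd∣det)))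
  where
  gcd∣det : gcd c d ∣ℤ a * d - b * c
  gcd∣det = ∣m∣n⇒∣m-n (∣n⇒∣m*n a (∣ᵤ⇒∣ (gcd[i,j]∣j c d))) (∣n⇒∣m*n b (∣ᵤ⇒∣ (gcd[i,j]∣i c d)))

∣i∣≡±i : ∀ i → ∃[ s ] + ∣ i ∣ ≡ s * i
∣i∣≡±i (+ n)    = + 1 , sym (ℤP.*-identityˡ (+ n))
∣i∣≡±i -[1+ n ] = - + 1 , sym (ℤP.-1*i≡-i -[1+ n ])

ℕ-bézout⇒ℤ : ∀ x y {c d} s t → + ∣ c ∣ ≡ s * c → + ∣ d ∣ ≡ t * d →
  1 ℕ.+ y ℕ.* ∣ d ∣ ≡ x ℕ.* ∣ c ∣ → + x * s * c - + y * t * d ≡ + 1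
ℕ-bézout⇒ℤ x y {c} {d} s t ∣c∣≡sc ∣d∣≡td 1+yd≡xc = begin
  + x * s * c - + y * t * d           ≡⟨ reassociate (+ x) (+ y) s t c d ⟩
  + x * (s * c) - + y * (t * d)       ≡⟨ cong₂ (λ u v → + x * u - + y * v) (sym ∣c∣≡sc) (sym ∣d∣≡td) ⟩
  + x * + ∣ c ∣ - + y * + ∣ d ∣       ≡⟨ cong₂ _-_ (sym (ℤP.pos-* x ∣ c ∣)) (sym (ℤP.pos-* y ∣ d ∣)) ⟩
  + (x ℕ.* ∣ c ∣) - + (y ℕ.* ∣ d ∣)   ≡⟨ cong (λ n → + n - + (y ℕ.* ∣ d ∣)) (sym 1+yd≡xc) ⟩
  + (1 ℕ.+ y ℕ.* ∣ d ∣) - + (y ℕ.* ∣ d ∣) ≡⟨ cong (_- + (y ℕ.* ∣ d ∣)) (ℤP.pos-+ 1 (y ℕ.* ∣ d ∣)) ⟩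
  + 1 + + (y ℕ.* ∣ d ∣) - + (y ℕ.* ∣ d ∣) ≡⟨ cancel (+ (y ℕ.* ∣ d ∣)) ⟩
  + 1                                 ∎
  where
  open ≡-Reasoning
  reassociate : ∀ x y s t c d → x * s * c - y * t * d ≡ x * (s * c) - y * (t * d)
  reassociate = solve-∀
  cancel : ∀ p → + 1 + p - p ≡ + 1
  cancel = solve-∀

coprime⇒bottomRow : ∀ c d → gcd c d ≡ + 1 → ∃[ a ] ∃[ b ] a * d - b * c ≡ + 1
coprime⇒bottomRow c d gcd≡1 with ∣i∣≡±i c | ∣i∣≡±i d
  | Bézout.identity (subst (GCD ∣ c ∣ ∣ d ∣) (ℤP.+-injective gcd≡1) (gcd-GCD ∣ c ∣ ∣ d ∣))
... | s , ∣c∣≡sc | t , ∣d∣≡td | Bézout.+- x y eq =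
  - (+ y * t) , - (+ x * s) ,
  trans (negate (+ x) (+ y) s t c d) (ℕ-bézout⇒ℤ x y s t ∣c∣≡sc ∣d∣≡td eq)
  where
  negate : ∀ x y s t c d → - (y * t) * d - - (x * s) * c ≡ x * s * c - y * t * d
  negate = solve-∀
... | s , ∣c∣≡sc | t , ∣d∣≡td | Bézout.-+ x y eq =
  + y * t , + x * s , ℕ-bézout⇒ℤ y x t s ∣d∣≡td ∣c∣≡sc eq

translate : ℤ → SL2Z → SL2Z
translate k (mat a b c d det) = mat (a - k * c) (b - k * d) c d (trans (shift a b c d k) det)
  where
  shift : ∀ a b c d k → (a - k * c) * d - (b - k * d) * c ≡ a * d - b * c
  shift = solve-∀

ρ-trace-translate : ∀ k A →
  ρ-trace-of (translate k A) ≡ ρ-trace-of A - k * (+ 2 * ρ-norm (c A) (d A))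
ρ-trace-translate k (mat a b c d _) = expanded a b c d k
  where
  expanded : ∀ a b c d k →
    + 2 * ((a - k * c) * c + (b - k * d) * d) + ((a - k * c) * d + (b - k * d) * c)
      ≡ + 2 * (a * c + b * d) + (a * d + b * c) - k * (+ 2 * (c * c + c * d + d * d))
  expanded = solve-∀

onSegment⇒n≡2ρ-norm : ∀ m (A : SL2Z) → OnSegment (suc m) (act A ρ) →
  + suc m ≡ + 2 * ρ-norm (c A) (d A)
onSegment⇒n≡2ρ-norm m A (im≡1/n , _) = sym (ι-injective (*-inverseʳ-unique
  (subst (λ y → ι (+ 2 * ρ-norm (c A) (d A)) ℚ.* y ≡ 1ℚ) im≡1/n (im-act-ρ A))
  (ι[n]*1/n≡1 m)))

trace<n⇒onSegment : ∀ m (A : SL2Z) → + suc m ≡ + 2 * ρ-norm (c A) (d A) →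
  ∀ {r} → ρ-trace-of A ≡ + r → r ℕ.< suc m → OnSegment (suc m) (act A ρ)
trace<n⇒onSegment m A n≡2K {r} M≡r r<n =
  im≡1/n , subst (0ℚ ℚ.≤_) (sym re≡r/n) (proj₁ (0≤r/n≤1 r<n))
         , subst (ℚ._≤ 1ℚ) (sym re≡r/n) (proj₂ (0≤r/n≤1 r<n))
  where
  open ≡-Reasoning
  im≡1/n : im (act A ρ) ≡ + 1 / suc m
  im≡1/n = *-inverseʳ-unique
    (trans (ℚP.*-comm (im (act A ρ)) (ι (+ suc m)))
           (subst (λ n → ι n ℚ.* im (act A ρ) ≡ 1ℚ) (sym n≡2K) (im-act-ρ A)))
    (trans (ℚP.*-comm (+ 1 / suc m) (ι (+ suc m))) (ι[n]*1/n≡1 m))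
  re≡r/n : re (act A ρ) ≡ + r / suc m
  re≡r/n = begin
    re (act A ρ)                       ≡⟨ re-act-ρ A ⟩
    ι (ρ-trace-of A) ℚ.* im (act A ρ)  ≡⟨ cong₂ ℚ._*_ (cong ι M≡r) im≡1/n ⟩
    ι (+ r) ℚ.* (+ 1 / suc m)          ≡⟨ ι*1/n≡/ (+ r) m ⟩
    + r / suc m                        ∎

ρ-trace-of-translate≡% : ∀ m (A : SL2Z) → + suc m ≡ + 2 * ρ-norm (c A) (d A) →
  ρ-trace-of (translate (ρ-trace-of A /ℕ suc m) A) ≡ + (ρ-trace-of A %ℕ suc m)
ρ-trace-of-translate≡% m A@(mat _ _ c d _) n≡2K = begin
  ρ-trace-of (translate k A)        ≡⟨ ρ-trace-translate k A ⟩
  M - k * (+ 2 * ρ-norm c d)        ≡⟨ cong (λ n → M - k * n) (sym n≡2K) ⟩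
  M - k * + suc m                   ≡⟨ cong (_- k * + suc m) (a≡a%ℕn+[a/ℕn]*n M (suc m)) ⟩
  + r + k * + suc m - k * + suc m   ≡⟨ cancel (+ r) (k * + suc m) ⟩
  + r                               ∎
  where
  open ≡-Reasoning
  M = ρ-trace-of A
  k = M /ℕ suc m
  r = M %ℕ suc m
  cancel : ∀ x y → x + y - y ≡ x
  cancel = solve-∀

coprime⇒onSegment : ∀ m c d → gcd c d ≡ + 1 → + suc m ≡ + 2 * ρ-norm c d →
  ∃[ A ] OnSegment (suc m) (act A ρ)
coprime⇒onSegment m c d gcd≡1 n≡2K =
  translate k A , trace<n⇒onSegment m (translate k A) n≡2K
                    (ρ-trace-of-translate≡% m A n≡2K) (n%ℕd<d (ρ-trace-of A) (suc m))
  where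
  A : SL2Z
  A = let a , b , det = coprime⇒bottomRow c d gcd≡1 in mat a b c d det
  k : ℤ
  k = ρ-trace-of A /ℕ suc m

segment-criterion : (n : ℕ) → .{{_ : NonZero n}} →
  (∃[ A ] OnSegment n (act A ρ)) ⇔ (∃[ c ] ∃[ d ] (gcd c d ≡ + 1) × (+ n ≡ + 2 * ρ-norm c d))
segment-criterion (suc m) = mk⇔
  (λ (A , onSegment) → c A , d A , det≡1⇒gcd≡1 (a A) (b A) (c A) (d A) (det≡1 A)
                                 , onSegment⇒n≡2ρ-norm m A onSegment)
  (λ (c , d , gcd≡1 , n≡2K) → coprime⇒onSegment m c d gcd≡1 n≡2K)

two-points-at-height-√3/14 :
  ∃[ A ] ∃[ B ] (act A ρ ≢ act B ρ) × OnSegment 14 (act A ρ) × OnSegment 14 (act B ρ)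
two-points-at-height-√3/14 = A , B , (λ Aρ≡Bρ → different-re (cong re Aρ≡Bρ)) , on-segment A , on-segment B
  where
  A B : SL2Z
  A = mat (+ 1) (+ 1) (+ 1) (+ 2) refl
  B = mat (+ 1) (+ 0) (+ 2) (+ 1) refl
  different-re : re (act A ρ) ≢ re (act B ρ)
  different-re ()
  on-segment : ∀ C → {_ : True (0ℚ ℚP.≤? re (act C ρ))} → {_ : True (re (act C ρ) ℚP.≤? 1ℚ)} →
    {_ : True (im (act C ρ) ℚP.≟ + 1 / 14)} → OnSegment 14 (act C ρ)
  on-segment C {p} {q} {r} = toWitness r , toWitness p , toWitness q

mainTheorem5 :
    ((n : ℕ) → .{{_ : NonZero n}} →
      (∃[ A ] OnSegment n (act A ρ))
        ⇔ (∃[ c ] ∃[ d ] (gcd c d ≡ + 1) × (+ n ≡ + 2 * (c * c + c * d + d * d))))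
    × (∃[ n ] Σ (NonZero n) λ nz →
        ∃[ A ] ∃[ B ] (act A ρ ≢ act B ρ)
          × OnSegment n {{nz}} (act A ρ) × OnSegment n {{nz}} (act B ρ))
mainTheorem5 = segment-criterion , 14 , _ , two-points-at-height-√3/14
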